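{- Let $V$ be a finite non-empty set, $p:2^V\to\mathbb{Z}$ a (fully) supermodular finite-valued function with $p(\emptyset)=0$, $B=\{x\in\mathbb{R}^V:\widetilde x(V)=p(V),\ \widetilde x(Z)\ge p(Z)\ \forall Z\subseteq V\}$, and let $f,g:V\to\mathbb{Z}$ with $f\le g$ be such that $B\cap T(f,g)\cap\mathbb{Z}^V\ne\emptyset$, where $T(f,g)=\{x: f\le x\le g\}$. Let $T\subseteq V$. Then there exist integral $f',g'$ with $T(f',g')\subseteq T(f,g)$ and a subset $X_T\subseteq V$ such that an element $m\in B\cap T(f,g)\cap\mathbb{Z}^V$ minimizes $\widetilde m(T)$ over $B\cap T(f,g)\cap\mathbb{Z}^V$ if and only if $\widetilde m(X_T)=p(X_T)$ and $m\in B\cap T(f',g')\cap\mathbb{Z}^V$.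
   Context: $\widetilde x(Z)=\sum_{v\in Z}x(v)$. -}

module Defs where

open import Data.Nat using (ℕ; suc)
open import Data.Integer using (ℤ; _+_; _≤_; 0ℤ)
open import Data.Fin using (Fin)
open import Data.Fin.Subset using (Subset; _∩_; _∪_; ⊥)
open import Data.Vec using (lookup)
open import Data.List using (List; map; allFin; sum) renaming (foldr to lfoldr)
open import Data.Bool using (Bool; true; false; if_then_else_)
open import Data.Product using (_×_)
open import Relation.Binary.PropositionalEquality using (_≡_)

Vect : ℕ → Set
Vect n = Fin n → ℤ

tilde : ∀ {n} → Vect n → Subset n → ℤ
tilde {n} x Z = lfoldr _+_ 0ℤ (map (λ v → if lookup Z v then x v else 0ℤ) (allFin n))

Supermodular : ∀ {n} → (Subset n → ℤ) → Set
Supermodular {n} p = ∀ (X Y : Subset n) → p X + p Y ≤ p (X ∩ Y) + p (X ∪ Y)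

InB : ∀ {n} → (Subset n → ℤ) → Vect n → Set
InB {n} p x = (tilde x (Data.Fin.Subset.⊤) ≡ p Data.Fin.Subset.⊤)
            × (∀ (Z : Subset n) → p Z ≤ tilde x Z)

InBox : ∀ {n} → Vect n → Vect n → Vect n → Set
InBox {n} f g x = ∀ (v : Fin n) → (f v ≤ x v) × (x v ≤ g v)

-- T(f',g') ⊆ T(f,g) (for integral bounds, equivalent to the real-box inclusion)
BoxSub : ∀ {n} → Vect n → Vect n → Vect n → Vect n → Set
BoxSub {n} f' g' f g = ∀ (x : Vect n) → InBox f' g' x → InBox f g x

Minimizes : ∀ {n} → (Subset n → ℤ) → Vect n → Vect n → Subset n → Vect n → Set
Minimizes {n} p f g T m =
  (InB p m × InBox f g m) × (∀ (y : Vect n) → InB p y → InBox f g y → tilde m T ≤ tilde y T)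

module Submission where

-- Start from any integral point of B ∩ T(f,g) and apply the exchanges x − χ_u + χ_v with
-- u ∈ T, f(u) < x(u) and v ∉ T, x(v) < g(v) as long as one of them stays in B. Each lowers
-- x̃(T) by one, and x̃(T) ≥ f̃(T), so this stops at some m₀. There, every such pair (u,v) is
-- separated by a set Z_uv that is tight for m₀, i.e. u ∈ Z_uv ∌ v and m̃₀(Z_uv) = p(Z_uv).
-- By supermodularity the tight sets of a point of B are closed under ∩ and ∪, so
-- Y = ⋃_u ⋂_v Z_uv is tight; it contains all u ∈ T with m₀(u) > f(u) and no v ∉ T with
-- m₀(v) < g(v). Comparing coordinatewise, every m ∈ T(f,g) satisfies
-- m̃₀(T) + m̃(Y) ≤ m̃(T) + m̃₀(Y) = m̃(T) + p(Y), with equality exactly when m lies in the box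
-- that freezes T ∖ Y at f and Y ∖ T at g. Together with m̃(Y) ≥ p(Y) this shows that m₀ is
-- a minimizer and characterizes the minimizers with X_T = Y.

open import Defs
open import Data.Nat using (ℕ; suc)
open import Data.Integer using (ℤ; _≤_; 0ℤ)
open import Data.Fin using (Fin)
open import Data.Fin.Subset using (Subset; ⊥)
open import Data.Product using (_×_; Σ; ∃; ∃-syntax)
open import Function.Bundles using (_⇔_)
open import Relation.Binary.PropositionalEquality using (_≡_)

open import Data.Bool using (Bool; true; false; _∧_; _∨_; if_then_else_)
open import Data.Bool.Properties
  using (∧-zeroʳ; ∨-zeroʳ; if-eta; if-cong; if-cong-then) renaming (_≟_ to _≟ᴮ_)
open import Data.Empty using (⊥-elim)
open import Data.Fin using (zero; suc; _≟_)
open import Data.Fin.Subset using (_∩_; _∪_; ⊤; ⋂; ⋃)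
open import Data.Fin.Subset.Properties using (anySubset?)
open import Data.Integer using (_+_; _-_; -_; _<_; _≰_; _<?_; 1ℤ; -1ℤ; +_; ∣_∣)
open import Data.Integer.Properties
  using ( ≤-refl; ≤-trans; ≤-antisym; ≤-reflexive; <-irrefl; ≤-<-trans; <-≤-trans; ≮⇒≥
        ; +-comm; +-assoc; +-identityˡ; +-identityʳ; +-mono-≤; +-monoˡ-≤; +-monoʳ-≤
        ; i<j⇒i≤pred[j]; i≤j⇒pred[i]≤j; i<j⇒suc[i]≤j; suc[i]≤j⇒i<j; i≤suc[i]; pred-suc
        ; i≤j⇒0≤j-i; 0≤i⇒+∣i∣≡i; +-0-commutativeMonoid; +-0-abelianGroup; module ≤-Reasoning)
open import Data.Integer.Tactic.RingSolver using (solve-∀)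
open import Data.List using (map; tabulate) renaming (foldr to foldrᴸ)
open import Data.Nat using (zero)
open import Data.Product using (_,_; proj₁; proj₂)
open import Data.Sum as Sum using (_⊎_; inj₁; inj₂)
open import Data.Vec using (_∷_; lookup)
open import Data.Vec.Properties using (lookup-zipWith; lookup-replicate)
open import Function using (_∘_; id; const; flip)
open import Function.Bundles using (Equivalence; mk⇔)
open import Relation.Binary.PropositionalEquality
  using (_≢_; refl; sym; trans; cong; cong₂; subst; subst₂; module ≡-Reasoning)
open import Relation.Nullary using (does; yes; no; contradiction)
open import Relation.Nullary.Decidable using (_×-dec_)

open import Algebra.Properties.AbelianGroup +-0-abelianGroup
  using () renaming (∙-cancelˡ to +-cancelˡ-≡; ∙-cancelʳ to +-cancelʳ-≡)
open import Algebra.Properties.CommutativeMonoid.Sum +-0-commutativeMonoid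
  using (sum; ∑-distrib-+; sum-cong-≗; sum-replicate-zero)

+-cancelʳ-≤ : ∀ c {a b} → a + c ≤ b + c → a ≤ b
+-cancelʳ-≤ c {a} {b} = subst₂ _≤_ (a+c-c≡a a c) (a+c-c≡a b c) ∘ +-monoˡ-≤ (- c)
  where
  a+c-c≡a : ∀ a c → a + c - c ≡ a
  a+c-c≡a = solve-∀

+-cancelˡ-≤ : ∀ c {a b} → c + a ≤ c + b → a ≤ b
+-cancelˡ-≤ c {a} {b} = +-cancelʳ-≤ c ∘ subst₂ _≤_ (+-comm c a) (+-comm c b)

+-mono-≤-equality : ∀ {a b c d} → a ≤ b → c ≤ d → b + d ≤ a + c → a ≡ b × c ≡ d
+-mono-≤-equality {a} {b} {c} {d} a≤b c≤d b+d≤a+c =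
  ≤-antisym a≤b (+-cancelʳ-≤ d (≤-trans b+d≤a+c (+-monoʳ-≤ a c≤d))) ,
  ≤-antisym c≤d (+-cancelˡ-≤ b (≤-trans b+d≤a+c (+-monoˡ-≤ c a≤b)))

sum-mono-≤ : ∀ {k} {a b : Fin k → ℤ} → (∀ i → a i ≤ b i) → sum a ≤ sum b
sum-mono-≤ {zero}  a≤b = ≤-refl
sum-mono-≤ {suc k} a≤b = +-mono-≤ (a≤b zero) (sum-mono-≤ (a≤b ∘ suc))

sum-mono-≤-equality : ∀ {k} {a b : Fin k → ℤ} → (∀ i → a i ≤ b i) → sum b ≤ sum a →
  ∀ i → a i ≡ b i
sum-mono-≤-equality {suc k} a≤b b≤a zero =
  proj₁ (+-mono-≤-equality (a≤b zero) (sum-mono-≤ (a≤b ∘ suc)) b≤a)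
sum-mono-≤-equality {suc k} a≤b b≤a (suc i) =
  sum-mono-≤-equality (a≤b ∘ suc)
    (≤-reflexive (sym (proj₂ (+-mono-≤-equality (a≤b zero) (sum-mono-≤ (a≤b ∘ suc)) b≤a)))) i

foldr-map-tabulate : ∀ {k N} (h : Fin N → ℤ) (e : Fin k → Fin N) →
  foldrᴸ _+_ 0ℤ (map h (tabulate e)) ≡ sum (h ∘ e)
foldr-map-tabulate {zero}  h e = refl
foldr-map-tabulate {suc k} h e = cong (_+_ (h (e zero))) (foldr-map-tabulate h (e ∘ suc))

restrict : ∀ {N} → Subset N → Vect N → Vect N
restrict Z x v = if lookup Z v then x v else 0ℤ

tilde≡sum : ∀ {N} (x : Vect N) Z → tilde x Z ≡ sum (restrict Z x)
tilde≡sum x Z = foldr-map-tabulate (restrict Z x) id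

tilde-cong : ∀ {N} {x y : Vect N} Z → (∀ v → x v ≡ y v) → tilde x Z ≡ tilde y Z
tilde-cong {x = x} {y} Z x≗y = begin
  tilde x Z            ≡⟨ tilde≡sum x Z ⟩
  sum (restrict Z x)   ≡⟨ sum-cong-≗ (λ v → if-cong-then (lookup Z v) (x≗y v)) ⟩
  sum (restrict Z y)   ≡⟨ tilde≡sum y Z ⟨
  tilde y Z            ∎
  where open ≡-Reasoning

tilde-+ : ∀ {N} (x y : Vect N) Z → tilde x Z + tilde y Z ≡ tilde (λ v → x v + y v) Z
tilde-+ x y Z = begin
  tilde x Z + tilde y Z                          ≡⟨ cong₂ _+_ (tilde≡sum x Z) (tilde≡sum y Z) ⟩
  sum (restrict Z x) + sum (restrict Z y)        ≡⟨ ∑-distrib-+ (restrict Z x) (restrict Z y) ⟨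
  sum (λ v → restrict Z x v + restrict Z y v)    ≡⟨ sum-cong-≗ restrict-+ ⟩
  sum (restrict Z (λ v → x v + y v))             ≡⟨ tilde≡sum _ Z ⟨
  tilde (λ v → x v + y v) Z                      ∎
  where
  open ≡-Reasoning
  restrict-+ : ∀ v → restrict Z x v + restrict Z y v ≡ restrict Z (λ w → x w + y w) v
  restrict-+ v with lookup Z v
  ... | true  = refl
  ... | false = refl

tilde-mono-≤ : ∀ {N} {x y : Vect N} Z → (∀ v → x v ≤ y v) → tilde x Z ≤ tilde y Z
tilde-mono-≤ {x = x} {y} Z x≤y =
  subst₂ _≤_ (sym (tilde≡sum x Z)) (sym (tilde≡sum y Z)) (sum-mono-≤ restrict-mono)
  where
  restrict-mono : ∀ v → restrict Z x v ≤ restrict Z y v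
  restrict-mono v with lookup Z v
  ... | true  = x≤y v
  ... | false = ≤-refl

tilde-⊥ : ∀ {N} (x : Vect N) → tilde x ⊥ ≡ 0ℤ
tilde-⊥ {N} x = begin
  tilde x ⊥               ≡⟨ tilde≡sum x ⊥ ⟩
  sum (restrict ⊥ x)      ≡⟨ sum-cong-≗ (λ v → if-cong {x = x v} (lookup-replicate v false)) ⟩
  sum {N} (λ _ → 0ℤ)      ≡⟨ sum-replicate-zero N ⟩
  0ℤ                      ∎
  where open ≡-Reasoning

tilde-∩-∪ : ∀ {N} (x : Vect N) A B →
  tilde x (A ∩ B) + tilde x (A ∪ B) ≡ tilde x A + tilde x B
tilde-∩-∪ x A B = begin
  tilde x (A ∩ B) + tilde x (A ∪ B)                       ≡⟨ cong₂ _+_ (tilde≡sum x (A ∩ B)) (tilde≡sum x (A ∪ B)) ⟩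
  sum (restrict (A ∩ B) x) + sum (restrict (A ∪ B) x)     ≡⟨ ∑-distrib-+ (restrict (A ∩ B) x) (restrict (A ∪ B) x) ⟨
  sum (λ v → restrict (A ∩ B) x v + restrict (A ∪ B) x v) ≡⟨ sum-cong-≗ modular ⟩
  sum (λ v → restrict A x v + restrict B x v)             ≡⟨ ∑-distrib-+ (restrict A x) (restrict B x) ⟩
  sum (restrict A x) + sum (restrict B x)                 ≡⟨ cong₂ _+_ (tilde≡sum x A) (tilde≡sum x B) ⟨
  tilde x A + tilde x B                                   ∎
  where
  open ≡-Reasoning
  modular : ∀ v → restrict (A ∩ B) x v + restrict (A ∪ B) x v ≡ restrict A x v + restrict B x v
  modular v rewrite lookup-zipWith _∧_ v A B | lookup-zipWith _∨_ v A B
    with lookup A v | lookup B v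
  ... | true  | true  = refl
  ... | true  | false = +-comm 0ℤ (x v)
  ... | false | true  = refl
  ... | false | false = refl

indicator : Bool → ℤ
indicator b = if b then 1ℤ else 0ℤ

indicator-nonneg : ∀ b → 0ℤ ≤ indicator b
indicator-nonneg true  = i≤suc[i] 0ℤ
indicator-nonneg false = ≤-refl

χ : ∀ {N} → Fin N → Vect N
χ u w = indicator (does (w ≟ u))

tilde-χ : ∀ {N} (Z : Subset N) u → tilde (χ u) Z ≡ indicator (lookup Z u)
tilde-χ Z u = trans (tilde≡sum (χ u) Z) (sum-restrict-χ Z u)
  where
  sum-restrict-χ : ∀ {N} (Z : Subset N) u → sum (restrict Z (χ u)) ≡ indicator (lookup Z u)
  sum-restrict-χ {suc N} (b ∷ Z) zero = trans
    (cong (_+_ (indicator b)) (trans (sum-cong-≗ (λ w → if-eta (lookup Z w))) (sum-replicate-zero N)))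
    (+-identityʳ (indicator b))
  sum-restrict-χ (b ∷ Z) (suc u) = trans (cong₂ _+_ (if-eta b) (sum-restrict-χ Z u)) (+-identityˡ _)

Tight : ∀ {N} → (Subset N → ℤ) → Vect N → Subset N → Set
Tight p x Z = tilde x Z ≡ p Z

tight-∩-∪ : ∀ {N} {p : Subset N → ℤ} {x : Vect N} → Supermodular p → (∀ Z → p Z ≤ tilde x Z) →
  ∀ {A B} → Tight p x A → Tight p x B → Tight p x (A ∩ B) × Tight p x (A ∪ B)
tight-∩-∪ {p = p} {x} supermodular x≥p {A} {B} tight-A tight-B =
  let ∩-tight , ∪-tight = +-mono-≤-equality (x≥p (A ∩ B)) (x≥p (A ∪ B)) (begin
        tilde x (A ∩ B) + tilde x (A ∪ B) ≡⟨ tilde-∩-∪ x A B ⟩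
        tilde x A + tilde x B             ≡⟨ cong₂ _+_ tight-A tight-B ⟩
        p A + p B                         ≤⟨ supermodular A B ⟩
        p (A ∩ B) + p (A ∪ B)             ∎)
  in sym ∩-tight , sym ∪-tight
  where open ≤-Reasoning

lookup-⋂-true : ∀ {k N} (F : Fin k → Subset N) w →
  (∀ i → lookup (F i) w ≡ true) → lookup (⋂ (tabulate F)) w ≡ true
lookup-⋂-true {zero}  F w _    = lookup-replicate w true
lookup-⋂-true {suc k} F w in-all = trans (lookup-zipWith _∧_ w (F zero) _)
  (cong₂ _∧_ (in-all zero) (lookup-⋂-true (F ∘ suc) w (in-all ∘ suc)))

lookup-⋂-false : ∀ {k N} (F : Fin k → Subset N) w i →
  lookup (F i) w ≡ false → lookup (⋂ (tabulate F)) w ≡ false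
lookup-⋂-false F w zero    out = trans (lookup-zipWith _∧_ w (F zero) _)
  (cong (_∧ lookup (⋂ (tabulate (F ∘ suc))) w) out)
lookup-⋂-false F w (suc i) out = trans (lookup-zipWith _∧_ w (F zero) _)
  (trans (cong (lookup (F zero) w ∧_) (lookup-⋂-false (F ∘ suc) w i out)) (∧-zeroʳ _))

lookup-⋃-true : ∀ {k N} (F : Fin k → Subset N) w i →
  lookup (F i) w ≡ true → lookup (⋃ (tabulate F)) w ≡ true
lookup-⋃-true F w zero    in′ = trans (lookup-zipWith _∨_ w (F zero) _)
  (cong (_∨ lookup (⋃ (tabulate (F ∘ suc))) w) in′)
lookup-⋃-true F w (suc i) in′ = trans (lookup-zipWith _∨_ w (F zero) _)
  (trans (cong (lookup (F zero) w ∨_) (lookup-⋃-true (F ∘ suc) w i in′)) (∨-zeroʳ _))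

lookup-⋃-false : ∀ {k N} (F : Fin k → Subset N) w →
  (∀ i → lookup (F i) w ≡ false) → lookup (⋃ (tabulate F)) w ≡ false
lookup-⋃-false {zero}  F w _      = lookup-replicate w false
lookup-⋃-false {suc k} F w out-all = trans (lookup-zipWith _∨_ w (F zero) _)
  (cong₂ _∨_ (out-all zero) (lookup-⋃-false (F ∘ suc) w (out-all ∘ suc)))

module LatticeFamily {N} (Closed : Subset N → Set)
  (closed-⊤ : Closed ⊤) (closed-⊥ : Closed ⊥)
  (closed-∩ : ∀ {A B} → Closed A → Closed B → Closed (A ∩ B))
  (closed-∪ : ∀ {A B} → Closed A → Closed B → Closed (A ∪ B)) where

  closed-⋂ : ∀ {k} (F : Fin k → Subset N) → (∀ i → Closed (F i)) → Closed (⋂ (tabulate F))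
  closed-⋂ {zero}  F _      = closed-⊤
  closed-⋂ {suc k} F closed = closed-∩ (closed zero) (closed-⋂ (F ∘ suc) (closed ∘ suc))

  closed-⋃ : ∀ {k} (F : Fin k → Subset N) → (∀ i → Closed (F i)) → Closed (⋃ (tabulate F))
  closed-⋃ {zero}  F _      = closed-⊥
  closed-⋃ {suc k} F closed = closed-∪ (closed zero) (closed-⋃ (F ∘ suc) (closed ∘ suc))

  separating-member : {U W : Fin N → Set} →
    (∀ u v → Σ (Subset N) λ Z → Closed Z ×
      (U u → lookup Z u ≡ true) × (W v → lookup Z v ≡ false)) →
    Σ (Subset N) λ Y → Closed Y ×
      (∀ u → U u → lookup Y u ≡ true) × (∀ v → W v → lookup Y v ≡ false)
  separating-member separate =
    ⋃ (tabulate D) ,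
    closed-⋃ D (λ u → closed-⋂ (Z u) (λ v → proj₁ (proj₂ (separate u v)))) ,
    (λ u Uu → lookup-⋃-true D u u
      (lookup-⋂-true (Z u) u λ v → proj₁ (proj₂ (proj₂ (separate u v))) Uu)) ,
    (λ v Wv → lookup-⋃-false D v λ u →
      lookup-⋂-false (Z u) v v (proj₂ (proj₂ (proj₂ (separate u v))) Wv))
    where
    Z : Fin N → Fin N → Subset N
    Z u v = proj₁ (separate u v)
    D : Fin N → Subset N
    D u = ⋂ (tabulate (Z u))

∀⊎⟶⊎∀ : ∀ {k} {A : Set} {B : Fin k → Set} → (∀ i → A ⊎ B i) → A ⊎ (∀ i → B i)
∀⊎⟶⊎∀ {zero}  _ = inj₂ λ ()
∀⊎⟶⊎∀ {suc k} a⊎b with a⊎b zero | ∀⊎⟶⊎∀ (a⊎b ∘ suc)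
... | inj₁ a | _       = inj₁ a
... | inj₂ _ | inj₁ a  = inj₁ a
... | inj₂ b | inj₂ bs = inj₂ λ where
  zero    → b
  (suc i) → bs i

module Descent {A : Set} {Good Stop : A → Set} (μ : A → ℤ) (b : ℤ)
  (bounded : ∀ {x} → Good x → b ≤ μ x)
  (step : ∀ {x} → Good x → (Σ A λ x′ → Good x′ × μ x′ < μ x) ⊎ Stop x) where

  descend-within : ∀ k {x} → Good x → μ x ≤ + k + b → Σ A λ m → Good m × Stop m
  descend-within zero {x} good μx≤b with step good
  ... | inj₂ stop = x , good , stop
  ... | inj₁ (_ , good′ , μx′<μx) = ⊥-elim (<-irrefl refl
    (≤-<-trans (bounded good′) (<-≤-trans μx′<μx (≤-trans μx≤b (≤-reflexive (+-identityˡ b))))))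
  descend-within (suc k) {x} good μx≤ with step good
  ... | inj₂ stop = x , good , stop
  ... | inj₁ (_ , good′ , μx′<μx) = descend-within k good′
    (subst (_ ≤_) (pred-suc (+ k + b))
      (i<j⇒i≤pred[j] (<-≤-trans μx′<μx (≤-trans μx≤ (≤-reflexive (+-assoc 1ℤ (+ k) b))))))

  descend : ∀ {x} → Good x → Σ A λ m → Good m × Stop m
  descend {x} good = descend-within ∣ μ x - b ∣ good (≤-reflexive (sym (begin
    + ∣ μ x - b ∣ + b ≡⟨ cong (_+ b) (0≤i⇒+∣i∣≡i (i≤j⇒0≤j-i (bounded good))) ⟩
    μ x - b + b       ≡⟨ i-j+j≡i (μ x) b ⟩
    μ x               ∎)))
    where
    open ≡-Reasoning
    i-j+j≡i : ∀ i j → i - j + j ≡ i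
    i-j+j≡i = solve-∀

exchange : ∀ {N} → Vect N → Fin N → Fin N → Vect N
exchange x u v w = x w - χ u w + χ v w

tilde-exchange : ∀ {N} (x : Vect N) u v Z →
  tilde (exchange x u v) Z + indicator (lookup Z u) ≡ tilde x Z + indicator (lookup Z v)
tilde-exchange x u v Z = begin
  tilde (exchange x u v) Z + indicator (lookup Z u)  ≡⟨ cong (_+_ (tilde (exchange x u v) Z)) (tilde-χ Z u) ⟨
  tilde (exchange x u v) Z + tilde (χ u) Z           ≡⟨ tilde-+ (exchange x u v) (χ u) Z ⟩
  tilde (λ w → exchange x u v w + χ u w) Z           ≡⟨ tilde-cong Z (λ w → a-b+c+b≡a+c (x w) (χ u w) (χ v w)) ⟩
  tilde (λ w → x w + χ v w) Z                        ≡⟨ tilde-+ x (χ v) Z ⟨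
  tilde x Z + tilde (χ v) Z                          ≡⟨ cong (_+_ (tilde x Z)) (tilde-χ Z v) ⟩
  tilde x Z + indicator (lookup Z v)                 ∎
  where
  open ≡-Reasoning
  a-b+c+b≡a+c : ∀ a b c → a - b + c + b ≡ a + c
  a-b+c+b≡a+c = solve-∀

-- The coordinates of exchange x u v at u and at v, in the form they compute to.
lower-by-one : ∀ {a b c} → a < b → b ≤ c → (a ≤ b - 1ℤ + 0ℤ) × (b - 1ℤ + 0ℤ ≤ c)
lower-by-one {b = b} a<b b≤c =
  subst (λ y → (_ ≤ y) × (y ≤ _)) (b-1≡b-1+0 b) (i<j⇒i≤pred[j] a<b , i≤j⇒pred[i]≤j b≤c)
  where
  b-1≡b-1+0 : ∀ b → -1ℤ + b ≡ b - 1ℤ + 0ℤ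
  b-1≡b-1+0 = solve-∀

raise-by-one : ∀ {a b c} → a ≤ b → b < c → (a ≤ b - 0ℤ + 1ℤ) × (b - 0ℤ + 1ℤ ≤ c)
raise-by-one {b = b} a≤b b<c =
  subst (λ y → (_ ≤ y) × (y ≤ _)) (1+b≡b-0+1 b) (≤-trans a≤b (i≤suc[i] b) , i<j⇒suc[i]≤j b<c)
  where
  1+b≡b-0+1 : ∀ b → 1ℤ + b ≡ b - 0ℤ + 1ℤ
  1+b≡b-0+1 = solve-∀

exchange-inBox : ∀ {N} {f g x : Vect N} {u v} → u ≢ v → f u < x u → x v < g v →
  InBox f g x → InBox f g (exchange x u v)
exchange-inBox {x = x} {u} {v} u≢v fu<xu xv<gv x∈box w with w ≟ u | w ≟ v
... | yes refl | yes refl = contradiction refl u≢v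
... | yes refl | no _     = lower-by-one fu<xu (proj₂ (x∈box w))
... | no _     | yes refl = raise-by-one (proj₁ (x∈box w)) xv<gv
... | no _     | no _     = subst (λ y → (_ ≤ y) × (y ≤ _)) (sym (a-0+0≡a (x w))) (x∈box w)
  where
  a-0+0≡a : ∀ a → a - 0ℤ + 0ℤ ≡ a
  a-0+0≡a = solve-∀

module FrozenBox {N} (f g : Vect N) (T Y : Subset N) (m₀ : Vect N)
  (at-lower : ∀ v → lookup T v ≡ true → lookup Y v ≡ false → m₀ v ≡ f v)
  (at-upper : ∀ v → lookup T v ≡ false → lookup Y v ≡ true → m₀ v ≡ g v) where

  f′ g′ : Vect N
  f′ v = if lookup T v then f v else (if lookup Y v then g v else f v)
  g′ v = if lookup T v then (if lookup Y v then g v else f v) else g v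

  frozen-⊆ : (∀ v → f v ≤ g v) → BoxSub f′ g′ f g
  frozen-⊆ f≤g x x∈box′ v with lookup T v | lookup Y v | x∈box′ v
  ... | true  | true  | fx , xg = fx , xg
  ... | true  | false | fx , xf = fx , ≤-trans xf (f≤g v)
  ... | false | true  | gx , xg = ≤-trans (f≤g v) gx , xg
  ... | false | false | fx , xg = fx , xg

  private
    L R : Vect N → Vect N
    L m v = restrict T m₀ v + restrict Y m v
    R m v = restrict T m v + restrict Y m₀ v

    sum-L : ∀ m → tilde m₀ T + tilde m Y ≡ sum (L m)
    sum-L m = trans (cong₂ _+_ (tilde≡sum m₀ T) (tilde≡sum m Y))
                    (sym (∑-distrib-+ (restrict T m₀) (restrict Y m)))

    sum-R : ∀ m → tilde m T + tilde m₀ Y ≡ sum (R m)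
    sum-R m = trans (cong₂ _+_ (tilde≡sum m T) (tilde≡sum m₀ Y))
                    (sym (∑-distrib-+ (restrict T m) (restrict Y m₀)))

    module _ {m : Vect N} (m∈box : InBox f g m) (v : Fin N) where
      L≤R : L m v ≤ R m v
      L≤R with lookup T v in Tv | lookup Y v in Yv
      ... | true  | true  = ≤-reflexive (+-comm (m₀ v) (m v))
      ... | true  | false =
        +-monoˡ-≤ 0ℤ (≤-trans (≤-reflexive (at-lower v Tv Yv)) (proj₁ (m∈box v)))
      ... | false | true  =
        +-monoʳ-≤ 0ℤ (≤-trans (proj₂ (m∈box v)) (≤-reflexive (sym (at-upper v Tv Yv))))
      ... | false | false = ≤-refl

      L≡R⇔frozen : L m v ≡ R m v ⇔ ((f′ v ≤ m v) × (m v ≤ g′ v))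
      L≡R⇔frozen with lookup T v in Tv | lookup Y v in Yv
      ... | true  | true  = mk⇔ (λ _ → m∈box v) (λ _ → +-comm (m₀ v) (m v))
      ... | true  | false = mk⇔
        (λ eq → proj₁ (m∈box v) , ≤-reflexive (trans (sym (+-cancelʳ-≡ 0ℤ _ _ eq)) (at-lower v Tv Yv)))
        (λ (_ , m≤f) → cong (_+ 0ℤ) (trans (at-lower v Tv Yv) (≤-antisym (proj₁ (m∈box v)) m≤f)))
      ... | false | true  = mk⇔
        (λ eq → ≤-reflexive (trans (sym (at-upper v Tv Yv)) (+-cancelˡ-≡ 0ℤ _ _ (sym eq))) , proj₂ (m∈box v))
        (λ (g≤m , _) → cong (_+_ 0ℤ) (trans (≤-antisym (proj₂ (m∈box v)) g≤m) (sym (at-upper v Tv Yv))))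
      ... | false | false = mk⇔ (λ _ → m∈box v) (λ _ → refl)

  cross-≤ : ∀ {m} → InBox f g m → tilde m₀ T + tilde m Y ≤ tilde m T + tilde m₀ Y
  cross-≤ {m} m∈box = subst₂ _≤_ (sym (sum-L m)) (sym (sum-R m)) (sum-mono-≤ (L≤R m∈box))

  cross-≡⇔frozen : ∀ {m} → InBox f g m →
    (tilde m₀ T + tilde m Y ≡ tilde m T + tilde m₀ Y) ⇔ InBox f′ g′ m
  cross-≡⇔frozen {m} m∈box = mk⇔
    (λ eq v → Equivalence.to (L≡R⇔frozen m∈box v)
      (sum-mono-≤-equality (L≤R m∈box) (≤-reflexive (trans (sym (sum-R m)) (trans (sym eq) (sum-L m)))) v))
    (λ m∈box′ → trans (sum-L m)
      (trans (sum-cong-≗ (λ v → Equivalence.from (L≡R⇔frozen m∈box v) (m∈box′ v))) (sym (sum-R m))))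

module BoxedBaseMinimization {N} (p : Subset N → ℤ) (supermodular : Supermodular p)
  (p⊥≡0 : p ⊥ ≡ 0ℤ) (f g : Vect N) (T : Subset N) where

  Feasible : Vect N → Set
  Feasible x = InB p x × InBox f g x

  Lowerable Raisable : Vect N → Fin N → Set
  Lowerable x u = lookup T u ≡ true × f u < x u
  Raisable  x v = lookup T v ≡ false × x v < g v

  Improvement : Vect N → Set
  Improvement x = Σ (Vect N) λ x′ → Feasible x′ × tilde x′ T < tilde x T

  Separator : Vect N → Fin N → Fin N → Set
  Separator x u v = Σ (Subset N) λ Z → Tight p x Z ×
    (Lowerable x u → lookup Z u ≡ true) × (Raisable x v → lookup Z v ≡ false)

  Certificate : Vect N → Set
  Certificate x = Σ (Subset N) λ Y → Tight p x Y ×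
    (∀ v → lookup T v ≡ true → lookup Y v ≡ false → x v ≡ f v) ×
    (∀ v → lookup T v ≡ false → lookup Y v ≡ true → x v ≡ g v)

  module Exchange {x u v} (x∈B : InB p x) (x∈box : InBox f g x)
    (lowerable : Lowerable x u) (raisable : Raisable x v) where

    u≢v : u ≢ v
    u≢v refl = contradiction (trans (sym (proj₁ lowerable)) (proj₁ raisable)) λ ()

    decreases : tilde (exchange x u v) T < tilde x T
    decreases = suc[i]≤j⇒i<j (≤-reflexive
      (trans (+-comm 1ℤ (tilde (exchange x u v) T)) (trans exchange-on-T (+-identityʳ (tilde x T)))))
      where
      exchange-on-T : tilde (exchange x u v) T + 1ℤ ≡ tilde x T + 0ℤ
      exchange-on-T = subst₂ (λ a b → tilde (exchange x u v) T + indicator a ≡ tilde x T + indicator b)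
        (proj₁ lowerable) (proj₁ raisable) (tilde-exchange x u v T)

    preserves-⊤ : tilde (exchange x u v) ⊤ ≡ p ⊤
    preserves-⊤ = trans (+-cancelʳ-≡ 1ℤ _ _ (subst₂
      (λ a b → tilde (exchange x u v) ⊤ + indicator a ≡ tilde x ⊤ + indicator b)
      (lookup-replicate u true) (lookup-replicate v true) (tilde-exchange x u v ⊤))) (proj₁ x∈B)

    violation-decreases : ∀ {Z} → tilde (exchange x u v) Z < p Z → tilde x Z ≰ tilde (exchange x u v) Z
    violation-decreases violated x≤x′ =
      <-irrefl refl (≤-<-trans (≤-trans (proj₂ x∈B _) x≤x′) violated)

    blocking : ∀ Z → tilde (exchange x u v) Z < p Z →
      Tight p x Z × lookup Z u ≡ true × lookup Z v ≡ false
    blocking Z violated with lookup Z u | lookup Z v | tilde-exchange x u v Z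
    ... | true  | false | exchange-on-Z = ≤-antisym (begin
          tilde x Z                          ≡⟨ +-identityʳ _ ⟨
          tilde x Z + 0ℤ                     ≡⟨ exchange-on-Z ⟨
          tilde (exchange x u v) Z + 1ℤ      ≡⟨ +-comm (tilde (exchange x u v) Z) 1ℤ ⟩
          1ℤ + tilde (exchange x u v) Z      ≤⟨ i<j⇒suc[i]≤j violated ⟩
          p Z                                ∎) (proj₂ x∈B Z) , refl , refl
          where open ≤-Reasoning
    ... | true  | true  | exchange-on-Z = contradiction
          (≤-reflexive (sym (+-cancelʳ-≡ 1ℤ _ _ exchange-on-Z)))
          (violation-decreases violated)
    ... | false | b     | exchange-on-Z = contradiction (begin
          tilde x Z                          ≡⟨ +-identityʳ _ ⟨
          tilde x Z + 0ℤ                     ≤⟨ +-monoʳ-≤ (tilde x Z) (indicator-nonneg b) ⟩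
          tilde x Z + indicator b            ≡⟨ exchange-on-Z ⟨
          tilde (exchange x u v) Z + 0ℤ      ≡⟨ +-identityʳ _ ⟩
          tilde (exchange x u v) Z           ∎) (violation-decreases violated)
          where open ≤-Reasoning

    feasible-or-blocked : Feasible (exchange x u v) ⊎
      Σ (Subset N) λ Z → Tight p x Z × lookup Z u ≡ true × lookup Z v ≡ false
    feasible-or-blocked with anySubset? (λ Z → tilde (exchange x u v) Z <? p Z)
    ... | yes (Z , violated) = inj₂ (Z , blocking Z violated)
    ... | no ¬violated = inj₁ ((preserves-⊤ , λ Z → ≮⇒≥ (λ violated → ¬violated (Z , violated))) ,
                               exchange-inBox u≢v (proj₂ lowerable) (proj₂ raisable) x∈box)

  improve-or-certify : ∀ {x} → Feasible x → Improvement x ⊎ Certificate x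
  improve-or-certify {x} (x∈B , x∈box) =
    Sum.map₂ certify (∀⊎⟶⊎∀ λ u → ∀⊎⟶⊎∀ λ v → separate u v)
    where
    tight-⊤ : Tight p x ⊤
    tight-⊤ = proj₁ x∈B

    tight-⊥ : Tight p x ⊥
    tight-⊥ = trans (tilde-⊥ x) (sym p⊥≡0)

    open LatticeFamily (Tight p x) tight-⊤ tight-⊥
      (λ tA tB → proj₁ (tight-∩-∪ supermodular (proj₂ x∈B) tA tB))
      (λ tA tB → proj₂ (tight-∩-∪ supermodular (proj₂ x∈B) tA tB))

    separate : ∀ u v → Improvement x ⊎ Separator x u v
    separate u v with (lookup T u ≟ᴮ true) ×-dec (f u <? x u) | (lookup T v ≟ᴮ false) ×-dec (x v <? g v)
    ... | no ¬lowerable | _ =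
      inj₂ (⊥ , tight-⊥ , flip contradiction ¬lowerable , λ _ → lookup-replicate v false)
    ... | yes _ | no ¬raisable =
      inj₂ (⊤ , tight-⊤ , (λ _ → lookup-replicate u true) , flip contradiction ¬raisable)
    ... | yes lowerable | yes raisable with Exchange.feasible-or-blocked x∈B x∈box lowerable raisable
    ...   | inj₁ feasible =
      inj₁ (exchange x u v , feasible , Exchange.decreases x∈B x∈box lowerable raisable)
    ...   | inj₂ (Z , tight , u∈Z , v∉Z) = inj₂ (Z , tight , const u∈Z , const v∉Z)

    certify : (∀ u v → Separator x u v) → Certificate x
    certify separators =
      let Y , tight-Y , lowerable⊆Y , raisable∩Y = separating-member separators
      in Y , tight-Y ,
         (λ v Tv Yv → ≤-antisym
           (≮⇒≥ λ fv<xv → contradiction (trans (sym (lowerable⊆Y v (Tv , fv<xv))) Yv) λ ())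
           (proj₁ (x∈box v))) ,
         (λ v Tv Yv → ≤-antisym
           (proj₂ (x∈box v))
           (≮⇒≥ λ xv<gv → contradiction (trans (sym Yv) (raisable∩Y v (Tv , xv<gv))) λ ()))

  minimum-with-certificate : ∀ {x} → Feasible x → Σ (Vect N) λ m₀ → Feasible m₀ × Certificate m₀
  minimum-with-certificate = Descent.descend (λ x → tilde x T) (tilde f T)
    (λ (_ , x∈box) → tilde-mono-≤ T (proj₁ ∘ x∈box)) improve-or-certify

  module Certified {m₀} (m₀-feasible : Feasible m₀) (Y : Subset N) (tight-Y : Tight p m₀ Y)
    (at-lower : ∀ v → lookup T v ≡ true → lookup Y v ≡ false → m₀ v ≡ f v)
    (at-upper : ∀ v → lookup T v ≡ false → lookup Y v ≡ true → m₀ v ≡ g v) where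

    open FrozenBox f g T Y m₀ at-lower at-upper public

    m₀-minimal : ∀ y → InB p y → InBox f g y → tilde m₀ T ≤ tilde y T
    m₀-minimal y y∈B y∈box = +-cancelʳ-≤ (p Y) (begin
      tilde m₀ T + p Y        ≤⟨ +-monoʳ-≤ (tilde m₀ T) (proj₂ y∈B Y) ⟩
      tilde m₀ T + tilde y Y  ≤⟨ cross-≤ y∈box ⟩
      tilde y T + tilde m₀ Y  ≡⟨ cong (_+_ (tilde y T)) tight-Y ⟩
      tilde y T + p Y         ∎)
      where open ≤-Reasoning

    minimizes⇔ : ∀ m → InB p m → InBox f g m →
      Minimizes p f g T m ⇔ ((tilde m Y ≡ p Y) × InB p m × InBox f′ g′ m)
    minimizes⇔ m m∈B m∈box = mk⇔ to from
      where
      to : Minimizes p f g T m → (tilde m Y ≡ p Y) × InB p m × InBox f′ g′ m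
      to (_ , m-minimal) =
        let mT≡m₀T , pY≡mY = +-mono-≤-equality
              (m-minimal m₀ (proj₁ m₀-feasible) (proj₂ m₀-feasible)) (proj₂ m∈B Y)
              (≤-trans (cross-≤ m∈box) (≤-reflexive (cong (_+_ (tilde m T)) tight-Y)))
        in sym pY≡mY , m∈B ,
           Equivalence.to (cross-≡⇔frozen m∈box)
             (cong₂ _+_ (sym mT≡m₀T) (trans (sym pY≡mY) (sym tight-Y)))

      from : (tilde m Y ≡ p Y) × InB p m × InBox f′ g′ m → Minimizes p f g T m
      from (mY≡pY , _ , m∈box′) = (m∈B , m∈box) , λ y y∈B y∈box →
        ≤-trans (≤-reflexive (sym m₀T≡mT)) (m₀-minimal y y∈B y∈box)
        where
        m₀T≡mT : tilde m₀ T ≡ tilde m T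
        m₀T≡mT = +-cancelʳ-≡ (tilde m Y) _ _
          (trans (Equivalence.from (cross-≡⇔frozen m∈box) m∈box′)
                 (cong (_+_ (tilde m T)) (trans tight-Y (sym mY≡pY))))

theorem9p9 : (n : ℕ) (p : Subset (suc n) → ℤ) → Supermodular p → p ⊥ ≡ 0ℤ →
    (f g : Vect (suc n)) → (∀ (v : Fin (suc n)) → f v ≤ g v) →
    (∃[ x ] (InB p x × InBox f g x)) →
    (T : Subset (suc n)) →
    ∃[ f' ] ∃[ g' ] ∃[ X ] (BoxSub f' g' f g ×
      (∀ (m : Vect (suc n)) → InB p m → InBox f g m →
        (Minimizes p f g T m ⇔ ((tilde m X ≡ p X) × InB p m × InBox f' g' m))))
theorem9p9 n p supermodular p⊥≡0 f g f≤g (x , x-feasible) T =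
  let open BoxedBaseMinimization p supermodular p⊥≡0 f g T
      m₀ , m₀-feasible , Y , tight-Y , at-lower , at-upper = minimum-with-certificate x-feasible
      open Certified m₀-feasible Y tight-Y at-lower at-upper
  in f′ , g′ , Y , frozen-⊆ f≤g , minimizes⇔
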